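{- There are infinitely many graphs $G$, with $n$ denoting the number of vertices of $G$, such that $\overline{\operatorname{Z}}(G)-\operatorname{Z}(G)=n-7$.
   Context: All graphs are finite, simple and undirected. Given a set $S$ of initially blue vertices (all others white), the zero forcing color change rule says that a blue vertex with exactly one white neighbor causes that neighbor to become blue. $S$ is a zero forcing set if repeatedly applying this rule eventually makes every vertex blue. $\operatorname{Z}(G)$ is the minimum cardinality of a zero forcing set of $G$. A minimal zero forcing set is a zero forcing set containing no other zero forcing set as a proper subset, and $\overline{\operatorname{Z}}(G)$ is the maximum size of a minimal zero forcing set of $G$. -}

module Defs where

open import Data.Nat using (ℕ; _≤_)
open import Data.Bool using (Bool; true; false)
open import Data.Fin using (Fin)
open import Data.Fin.Subset using (Subset; _∈_; _∉_; _⊂_; ∣_∣; ⊤; inside)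
open import Data.Vec using (_[_]≔_)
open import Data.Product using (Σ; _×_; ∃)
open import Relation.Nullary using (¬_)
open import Relation.Binary.PropositionalEquality using (_≡_; _≢_)

record Graph (n : ℕ) : Set where
  field
    adj     : Fin n → Fin n → Bool
    sym     : ∀ i j → adj i j ≡ adj j i
    irrefl  : ∀ i → adj i i ≡ false
open Graph public

data Force {n : ℕ} (G : Graph n) (B : Subset n) : Subset n → Set where
  force : (u v : Fin n) → u ∈ B → v ∉ B → adj G u v ≡ true →
          (∀ w → adj G u w ≡ true → w ≢ v → w ∈ B) →
          Force G B (B [ v ]≔ inside)

data Forces {n : ℕ} (G : Graph n) : Subset n → Subset n → Set where
  done : ∀ {B} → Forces G B B
  step : ∀ {B C D} → Force G B C → Forces G C D → Forces G B D

IsZFS : {n : ℕ} → Graph n → Subset n → Set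
IsZFS G S = Forces G S ⊤

IsMinimalZFS : {n : ℕ} → Graph n → Subset n → Set
IsMinimalZFS G S = IsZFS G S × (∀ T → T ⊂ S → ¬ IsZFS G T)

IsZ : {n : ℕ} → Graph n → ℕ → Set
IsZ G k = (Σ _ λ S → IsZFS G S × ∣ S ∣ ≡ k) × (∀ S → IsZFS G S → k ≤ ∣ S ∣)

IsZbar : {n : ℕ} → Graph n → ℕ → Set
IsZbar G k = (Σ _ λ S → IsMinimalZFS G S × ∣ S ∣ ≡ k) × (∀ S → IsMinimalZFS G S → ∣ S ∣ ≤ k)

{-# OPTIONS --safe #-}
-- Let G be the cycle C_m (m ≥ 6, the rim) together with a hub adjacent to every other
-- vertex and two nonadjacent twins adjacent to the hub and to the whole rim, so n = m + 3.
-- Every vertex has degree at least 5, and the first force of a zero forcing set needs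
-- the forcing vertex and all but one of its neighbours blue, so Z(G) ≥ 5; the hub, the
-- twins and two consecutive rim vertices force the rim around the cycle, so Z(G) = 5.
-- For every vertex w, removing the hub and w from V leaves a zero forcing set (a
-- neighbour of the hub not adjacent to w forces the hub, which then forces w), so a
-- minimal zero forcing set misses at least two vertices. Removing the hub and a twin
-- gives a minimal one: dropping any further vertex leaves every blue vertex with two
-- white neighbours. Hence Zbar(G) = n − 2 and Zbar(G) − Z(G) = n − 7.
module Submission where

open import Defs hiding (sym)
open import Data.Bool using (Bool; true; false; _∨_)
open import Data.Bool.Properties using (∨-comm)
open import Data.Empty using (⊥-elim)
open import Data.Fin using (Fin; zero; suc; toℕ; fromℕ<; inject₁)
open import Data.Fin.Properties
  using (_≟_; any?; toℕ<n; toℕ-injective; toℕ-fromℕ<; toℕ-inject₁)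
  renaming (suc-injective to Fin-suc-injective)
open import Data.Fin.Subset
  using (Subset; _∈_; _∉_; _⊆_; _⊂_; ∣_∣; ⊤; ⊥; inside; outside; ⁅_⁆; _∪_)
open import Data.Fin.Subset.Properties
  using (_∈?_; ∈⊤; ⊆⊤; ⊆-antisym; p⊆q⇒∣p∣≤∣q∣; p⊂q⇒∣p∣<∣q∣; ∣p∣≤∣x∷p∣; ∣⊤∣≡n; ∣⊥∣≡0;
         ∣⁅x⁆∣≡1; x∈⁅x⁆; x∈⁅y⁆⇒x≡y; p⊆p∪q; q⊆p∪q; x∈p∪q⁻)
open import Data.Integer using (+_; _-_)
import Data.Nat as ℕ
open import Data.Nat using (ℕ; suc; zero; _+_; _≤_; _<_; z≤n; s≤s)
open import Data.Nat.Properties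
  using (≤-refl; ≤-trans; ≤-reflexive; ≤-pred; <-trans; n≤1+n; n<1+n; m≤n⇒m≤1+n; 1+n≢n;
         1+n≰n; <⇒≢; ≤∧≢⇒<; m<n+m; m≤n+m; m≤n⇒m<n∨m≡n; suc-injective; +-suc; +-comm;
         module ≤-Reasoning)
open import Data.Product using (Σ; _×_; _,_; ∃-syntax)
open import Data.Sum using (_⊎_; inj₁; inj₂; swap)
open import Data.Vec using (_∷_; _[_]≔_; tabulate; here; there)
open import Data.Vec.Properties
  using ([]≔-updates; []≔-minimal; []=-injective; []=⇒lookup; lookup⇒[]=; lookup∘update′;
         lookup∘tabulate; tabulate-cong; tabulate∘lookup; lookup-replicate)
open import Function using (_∘_)
open import Relation.Nullary using (¬_; Dec; yes; no; does; contradiction)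
open import Relation.Nullary.Decidable
  using (dec-true; dec-false; decidable-stable; ¬?; _⊎-dec_; _×-dec_)
open import Relation.Binary.PropositionalEquality
  using (_≡_; _≢_; refl; sym; trans; cong; subst; subst₂)

does≡true⇒ : ∀ {a} {A : Set a} (a? : Dec A) → does a? ≡ true → A
does≡true⇒ (yes a) _ = a

x∈p[x]≔inside : ∀ {n} (p : Subset n) x → x ∈ p [ x ]≔ inside
x∈p[x]≔inside p x = []≔-updates p x

x∉p[x]≔outside : ∀ {n} (p : Subset n) x → x ∉ p [ x ]≔ outside
x∉p[x]≔outside p x x∈ = contradiction ([]=-injective x∈ ([]≔-updates p x)) λ ()

x∈p∧x≢y⇒x∈p[y]≔b : ∀ {n} {p : Subset n} {x y b} → x ∈ p → x ≢ y → x ∈ p [ y ]≔ b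
x∈p∧x≢y⇒x∈p[y]≔b {p = p} {x} {y} x∈p x≢y = []≔-minimal p x y x≢y x∈p

x∈p[y]≔b∧x≢y⇒x∈p : ∀ {n} {p : Subset n} {x y b} → x ∈ p [ y ]≔ b → x ≢ y → x ∈ p
x∈p[y]≔b∧x≢y⇒x∈p {p = p} {x} {b = b} x∈ x≢y =
  lookup⇒[]= x p (trans (sym (lookup∘update′ x≢y p b)) ([]=⇒lookup x∈))

∣p[x]≔inside∣≤1+∣p∣ : ∀ {n} (p : Subset n) x → ∣ p [ x ]≔ inside ∣ ≤ suc ∣ p ∣
∣p[x]≔inside∣≤1+∣p∣ (b ∷ p)       zero    = s≤s (∣p∣≤∣x∷p∣ b p)
∣p[x]≔inside∣≤1+∣p∣ (inside ∷ p)  (suc x) = s≤s (∣p[x]≔inside∣≤1+∣p∣ p x)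
∣p[x]≔inside∣≤1+∣p∣ (outside ∷ p) (suc x) = ∣p[x]≔inside∣≤1+∣p∣ p x

x≢y⇒2≤∣⁅x⁆∪⁅y⁆∣ : ∀ {n} {x y : Fin n} → x ≢ y → 2 ≤ ∣ ⁅ x ⁆ ∪ ⁅ y ⁆ ∣
x≢y⇒2≤∣⁅x⁆∪⁅y⁆∣ {x = x} {y} x≢y =
  subst (λ c → suc c ≤ ∣ ⁅ x ⁆ ∪ ⁅ y ⁆ ∣) (∣⁅x⁆∣≡1 x) (p⊂q⇒∣p∣<∣q∣ ⁅x⁆⊂⁅x⁆∪⁅y⁆)
  where
  ⁅x⁆⊂⁅x⁆∪⁅y⁆ : ⁅ x ⁆ ⊂ ⁅ x ⁆ ∪ ⁅ y ⁆
  ⁅x⁆⊂⁅x⁆∪⁅y⁆ = p⊆p∪q ⁅ y ⁆ , y , q⊆p∪q ⁅ x ⁆ ⁅ y ⁆ (x∈⁅x⁆ y) ,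
                λ y∈⁅x⁆ → x≢y (sym (x∈⁅y⁆⇒x≡y x y∈⁅x⁆))

x∈tabulate⁺ : ∀ {n} {f : Fin n → Bool} {x} → f x ≡ true → x ∈ tabulate f
x∈tabulate⁺ {f = f} {x} fx = lookup⇒[]= x (tabulate f) (trans (lookup∘tabulate f x) fx)

x∈tabulate⁻ : ∀ {n} {f : Fin n → Bool} {x} → x ∈ tabulate f → f x ≡ true
x∈tabulate⁻ {f = f} {x} x∈ = trans (sym (lookup∘tabulate f x)) ([]=⇒lookup x∈)

upTo : ∀ {n} → ℕ → Subset n
upTo j = tabulate λ t → does (toℕ t ℕ.≤? j)

x∈upTo⁺ : ∀ {n} {x : Fin n} {j} → toℕ x ≤ j → x ∈ upTo j
x∈upTo⁺ x≤j = x∈tabulate⁺ (dec-true (_ ℕ.≤? _) x≤j)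

x∈upTo⁻ : ∀ {n} {x : Fin n} {j} → x ∈ upTo j → toℕ x ≤ j
x∈upTo⁻ x∈ = does≡true⇒ (_ ℕ.≤? _) (x∈tabulate⁻ x∈)

upTo-full : ∀ {n j} → n ≤ suc j → upTo {n} j ≡ ⊤
upTo-full n≤1+j = ⊆-antisym ⊆⊤ λ {x} _ → x∈upTo⁺ (≤-pred (≤-trans (toℕ<n x) n≤1+j))

upTo-extend : ∀ {n} {x : Fin n} {j} → toℕ x ≡ suc j → upTo j [ x ]≔ inside ≡ upTo (suc j)
upTo-extend {x = x} {j} x≡1+j = ⊆-antisym extended⊆ ⊆extended
  where
  extended⊆ : upTo j [ x ]≔ inside ⊆ upTo (suc j)
  extended⊆ {y} y∈ with y ≟ x
  ... | yes refl = x∈upTo⁺ (≤-reflexive x≡1+j)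
  ... | no y≢x   = x∈upTo⁺ (m≤n⇒m≤1+n (x∈upTo⁻ (x∈p[y]≔b∧x≢y⇒x∈p y∈ y≢x)))
  ⊆extended : upTo (suc j) ⊆ upTo j [ x ]≔ inside
  ⊆extended {y} y∈ with y ≟ x
  ... | yes refl = x∈p[x]≔inside _ x
  ... | no y≢x   = x∈p∧x≢y⇒x∈p[y]≔b (x∈upTo⁺ (≤-pred (≤∧≢⇒< (x∈upTo⁻ y∈) y≢1+j))) y≢x
    where
    y≢1+j : toℕ y ≢ suc j
    y≢1+j e = y≢x (toℕ-injective (trans e (sym x≡1+j)))

tabulate-false≡⊥ : ∀ {n} → tabulate {n = n} (λ _ → false) ≡ ⊥
tabulate-false≡⊥ = trans (tabulate-cong λ i → sym (lookup-replicate i false)) (tabulate∘lookup ⊥)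

adj⇒≢ : ∀ {n} (G : Graph n) {x y} → adj G x y ≡ true → x ≢ y
adj⇒≢ G {x} xy refl = contradiction (trans (sym xy) (irrefl G x)) λ ()

neighbours : ∀ {n} → Graph n → Fin n → Subset n
neighbours G x = tabulate (adj G x)

x∈neighbours⁺ : ∀ {n} (G : Graph n) {u x} → adj G u x ≡ true → x ∈ neighbours G u
x∈neighbours⁺ G {u} = x∈tabulate⁺ {f = adj G u}

x∈neighbours⁻ : ∀ {n} (G : Graph n) {u x} → x ∈ neighbours G u → adj G u x ≡ true
x∈neighbours⁻ G {u} = x∈tabulate⁻ {f = adj G u}

zfs-size-≥-minDegree : ∀ {n d} (G : Graph (suc n)) → (∀ x → d ≤ ∣ neighbours G x ∣) →
                       ∀ {S} → IsZFS G S → d ≤ ∣ S ∣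
zfs-size-≥-minDegree G δ done = ≤-trans (δ zero) (p⊆q⇒∣p∣≤∣q∣ {p = neighbours G zero} ⊆⊤)
zfs-size-≥-minDegree G δ {S} (step (force u v u∈S v∉S _ others) _) =
  ≤-pred (≤-trans (s≤s (δ u)) (≤-trans (p⊂q⇒∣p∣<∣q∣ N⊂S′) (∣p[x]≔inside∣≤1+∣p∣ S v)))
  where
  N⊆S′ : neighbours G u ⊆ S [ v ]≔ inside
  N⊆S′ {w} w∈N with w ≟ v
  ... | yes refl = x∈p[x]≔inside S v
  ... | no w≢v   = x∈p∧x≢y⇒x∈p[y]≔b (others w (x∈neighbours⁻ G w∈N) w≢v) w≢v
  N⊂S′ : neighbours G u ⊂ S [ v ]≔ inside
  N⊂S′ = N⊆S′ , u , x∈p∧x≢y⇒x∈p[y]≔b u∈S (λ { refl → v∉S u∈S }) ,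
         λ u∈N → adj⇒≢ G (x∈neighbours⁻ G u∈N) refl

record TwoWhiteNeighbours {n} (G : Graph n) (B : Subset n) (u : Fin n) : Set where
  constructor twoWhite
  field
    w₁ w₂     : Fin n
    distinct  : w₁ ≢ w₂
    adjacent₁ : adj G u w₁ ≡ true
    adjacent₂ : adj G u w₂ ≡ true
    white₁    : w₁ ∉ B
    white₂    : w₂ ∉ B

stalled⇒¬zfs : ∀ {n} (G : Graph n) {B x} → x ∉ B → (∀ u → u ∈ B → TwoWhiteNeighbours G B u) →
               ¬ IsZFS G B
stalled⇒¬zfs G x∉B _ done = x∉B ∈⊤
stalled⇒¬zfs G _ stuck (step (force u v u∈B _ _ others) _) with stuck u u∈B
... | twoWhite w₁ w₂ w₁≢w₂ uw₁ uw₂ w₁∉B w₂∉B with w₁ ≟ v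
...   | yes refl = w₂∉B (others w₂ uw₂ (w₁≢w₂ ∘ sym))
...   | no w₁≢v  = w₁∉B (others w₁ uw₁ w₁≢v)

⊤-minus-two-zfs : ∀ {n} (G : Graph n) {a w u} → adj G a w ≡ true → adj G u a ≡ true →
                  adj G u w ≡ false → u ≢ w → IsZFS G (⊤ [ a ]≔ outside [ w ]≔ outside)
⊤-minus-two-zfs G {a} {w} {u} aw ua uw u≢w =
  step (force u a (∈T (adj⇒≢ G ua) u≢w) a∉T ua others-of-u)
  (step (force a w (x∈p[x]≔inside T a) w∉T′ aw λ z _ → ∈T′)
  (subst (λ B → Forces G B ⊤) (sym T″≡⊤) done))
  where
  T = ⊤ [ a ]≔ outside [ w ]≔ outside
  a≢w = adj⇒≢ G aw
  ∈T : ∀ {z} → z ≢ a → z ≢ w → z ∈ T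
  ∈T z≢a z≢w = x∈p∧x≢y⇒x∈p[y]≔b (x∈p∧x≢y⇒x∈p[y]≔b ∈⊤ z≢a) z≢w
  a∉T : a ∉ T
  a∉T a∈T = x∉p[x]≔outside ⊤ a (x∈p[y]≔b∧x≢y⇒x∈p a∈T a≢w)
  others-of-u : ∀ z → adj G u z ≡ true → z ≢ a → z ∈ T
  others-of-u z uz z≢a = ∈T z≢a λ { refl → contradiction (trans (sym uz) uw) λ () }
  w∉T′ : w ∉ T [ a ]≔ inside
  w∉T′ w∈ = x∉p[x]≔outside _ w (x∈p[y]≔b∧x≢y⇒x∈p w∈ (a≢w ∘ sym))
  ∈T′ : ∀ {z} → z ≢ w → z ∈ T [ a ]≔ inside
  ∈T′ {z} z≢w with z ≟ a
  ... | yes refl = x∈p[x]≔inside T a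
  ... | no z≢a   = x∈p∧x≢y⇒x∈p[y]≔b (∈T z≢a z≢w) z≢a
  T″≡⊤ : T [ a ]≔ inside [ w ]≔ inside ≡ ⊤
  T″≡⊤ = ⊆-antisym ⊆⊤ λ {z} _ → ∈T″ z
    where
    ∈T″ : ∀ z → z ∈ T [ a ]≔ inside [ w ]≔ inside
    ∈T″ z with z ≟ w
    ... | yes refl = x∈p[x]≔inside _ w
    ... | no z≢w   = x∈p∧x≢y⇒x∈p[y]≔b (∈T′ z≢w) z≢w

two-outside⇒2+∣S∣≤n : ∀ {n} {S : Subset n} {x y} → x ≢ y → x ∉ S → y ∉ S → 2 + ∣ S ∣ ≤ n
two-outside⇒2+∣S∣≤n {n} {S} {x} {y} x≢y x∉S y∉S = begin
  2 + ∣ S ∣                ≤⟨ s≤s (p⊂q⇒∣p∣<∣q∣ S⊂⊤-x) ⟩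
  suc ∣ ⊤ [ x ]≔ outside ∣ ≤⟨ p⊂q⇒∣p∣<∣q∣ ⊤-x⊂⊤ ⟩
  ∣ ⊤ {n} ∣                ≡⟨ ∣⊤∣≡n n ⟩
  n                        ∎
  where
  open ≤-Reasoning
  S⊂⊤-x : S ⊂ ⊤ [ x ]≔ outside
  S⊂⊤-x = (λ z∈S → x∈p∧x≢y⇒x∈p[y]≔b ∈⊤ λ { refl → x∉S z∈S }) ,
          y , x∈p∧x≢y⇒x∈p[y]≔b ∈⊤ (x≢y ∘ sym) , y∉S
  ⊤-x⊂⊤ : ⊤ [ x ]≔ outside ⊂ ⊤ {n}
  ⊤-x⊂⊤ = ⊆⊤ , x , ∈⊤ , x∉p[x]≔outside ⊤ x

at-most-one-outside : ∀ {n} {S : Subset (suc n)} → ¬ (2 + ∣ S ∣ ≤ suc n) →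
                      ∃[ w ] ∀ z → z ≢ w → z ∈ S
at-most-one-outside {S = S} unbounded with any? (λ x → ¬? (x ∈? S))
... | yes (w , w∉S) = w , λ z z≢w →
  decidable-stable (z ∈? S) λ z∉S → unbounded (two-outside⇒2+∣S∣≤n z≢w z∉S w∉S)
... | no nothing-outside = zero , λ z _ →
  decidable-stable (z ∈? S) λ z∉S → nothing-outside (z , z∉S)

minimal-zfs-size-≤ : ∀ {n} (G : Graph (suc n)) →
                     (∀ w → ∃[ T ] IsZFS G T × w ∉ T × ∃[ y ] y ≢ w × y ∉ T) →
                     ∀ {S} → IsMinimalZFS G S → 2 + ∣ S ∣ ≤ suc n
minimal-zfs-size-≤ {n} G avoiding {S} (_ , minimal) with 2 + ∣ S ∣ ℕ.≤? suc n
... | yes bounded = bounded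
... | no unbounded with at-most-one-outside unbounded
...   | w , rest∈S with avoiding w
...     | T , T-zfs , w∉T , y , y≢w , y∉T =
  ⊥-elim (minimal T ((λ {z} z∈T → rest∈S z λ { refl → w∉T z∈T }) , y , rest∈S y y≢w , y∉T) T-zfs)

module Construction (k : ℕ) where

  m : ℕ
  m = 6 + k

  Follows : ℕ → ℕ → Set
  Follows i j = suc i ≡ j ⊎ (j ≡ 0 × suc i ≡ m)

  follows? : ∀ i j → Dec (Follows i j)
  follows? i j = (suc i ℕ.≟ j) ⊎-dec ((j ℕ.≟ 0) ×-dec (suc i ℕ.≟ m))

  CycleAdjacent : ℕ → ℕ → Set
  CycleAdjacent i j = Follows i j ⊎ Follows j i

  cycleAdjacent? : ∀ i j → Dec (CycleAdjacent i j)
  cycleAdjacent? i j = follows? i j ⊎-dec follows? j i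

  ¬Follows-refl : ∀ i → ¬ Follows i i
  ¬Follows-refl i (inj₁ 1+i≡i)       = 1+n≢n 1+i≡i
  ¬Follows-refl _ (inj₂ (refl , ()))

  ¬CycleAdjacent-+2 : ∀ i → ¬ CycleAdjacent i (2 + i)
  ¬CycleAdjacent-+2 i (inj₁ (inj₁ 1+i≡2+i))   = 1+n≢n (sym (suc-injective 1+i≡2+i))
  ¬CycleAdjacent-+2 i (inj₁ (inj₂ (() , _)))
  ¬CycleAdjacent-+2 i (inj₂ (inj₁ 3+i≡i))      = <⇒≢ (m<n+m i (s≤s z≤n)) (sym 3+i≡i)
  ¬CycleAdjacent-+2 _ (inj₂ (inj₂ (refl , ())))

  cycle-neighbours : ∀ {t} → t < m →
                     ∃[ p ] ∃[ q ] p < m × q < m × p ≢ q × CycleAdjacent t p × CycleAdjacent t q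
  cycle-neighbours {zero} _ =
    1 , 5 + k , s≤s (s≤s z≤n) , ≤-refl , (λ ()) , inj₁ (inj₁ refl) , inj₂ (inj₂ (refl , refl))
  cycle-neighbours {suc t} 1+t<m with m≤n⇒m<n∨m≡n 1+t<m
  ... | inj₁ 2+t<m = t , 2 + t , <-trans (n<1+n t) 1+t<m , 2+t<m , <⇒≢ (m<n+m t (s≤s z≤n)) ,
                     inj₂ (inj₁ refl) , inj₁ (inj₁ refl)
  ... | inj₂ 2+t≡m = t , 0 , <-trans (n<1+n t) 1+t<m , s≤s z≤n ,
                     (λ { refl → contradiction 2+t≡m λ () }) ,
                     inj₂ (inj₁ refl) , inj₁ (inj₂ (refl , 2+t≡m))

  cycleAdjacent-≤ : ∀ {j t} → 1 ≤ j → CycleAdjacent j t → t ≢ suc j → t ≤ j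
  cycleAdjacent-≤ _   (inj₁ (inj₁ 1+j≡t))        t≢1+j = contradiction (sym 1+j≡t) t≢1+j
  cycleAdjacent-≤ _   (inj₁ (inj₂ (refl , _)))   _     = z≤n
  cycleAdjacent-≤ _   (inj₂ (inj₁ refl))         _     = n≤1+n _
  cycleAdjacent-≤ 1≤0 (inj₂ (inj₂ (refl , _)))   _     = contradiction 1≤0 λ ()

  V : Set
  V = Fin (3 + m)

  pattern hub   = zero
  pattern twin₁ = suc zero
  pattern twin₂ = suc (suc zero)
  pattern rim i = suc (suc (suc i))

  withHubAndTwins : Subset m → Subset (3 + m)
  withHubAndTwins p = inside ∷ inside ∷ inside ∷ p

  rim-injective : ∀ {i j} → _≡_ {A = V} (rim i) (rim j) → i ≡ j
  rim-injective = Fin-suc-injective ∘ Fin-suc-injective ∘ Fin-suc-injective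

  -- Each edge is listed once, with an orientation (the rim along Follows); G symmetrises it.
  arc : V → V → Bool
  arc hub     hub     = false
  arc hub     _       = true
  arc twin₁   (rim _) = true
  arc twin₂   (rim _) = true
  arc (rim i) (rim j) = does (follows? (toℕ i) (toℕ j))
  arc _       _       = false

  arc-irrefl : ∀ x → arc x x ≡ false
  arc-irrefl hub     = refl
  arc-irrefl twin₁   = refl
  arc-irrefl twin₂   = refl
  arc-irrefl (rim i) = dec-false (follows? (toℕ i) (toℕ i)) (¬Follows-refl (toℕ i))

  G : Graph (3 + m)
  G = record
    { adj    = λ x y → arc x y ∨ arc y x
    ; sym    = λ x y → ∨-comm (arc x y) (arc y x)
    ; irrefl = λ x → cong (λ b → b ∨ b) (arc-irrefl x)
    }

  rim-adjacent⁺ : ∀ {i j} → CycleAdjacent (toℕ i) (toℕ j) → adj G (rim i) (rim j) ≡ true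
  rim-adjacent⁺ {i} {j} = dec-true (cycleAdjacent? (toℕ i) (toℕ j))

  rim-adjacent⁻ : ∀ {i j} → adj G (rim i) (rim j) ≡ true → CycleAdjacent (toℕ i) (toℕ j)
  rim-adjacent⁻ {i} {j} = does≡true⇒ (cycleAdjacent? (toℕ i) (toℕ j))

  rim-neighbours : ∀ (i : Fin m) →
                   ∃[ j ] ∃[ l ] j ≢ l × CycleAdjacent (toℕ i) (toℕ j)
                                       × CycleAdjacent (toℕ i) (toℕ l)
  rim-neighbours i with cycle-neighbours (toℕ<n i)
  ... | p , q , p<m , q<m , p≢q , i~p , i~q =
    fromℕ< p<m , fromℕ< q<m , (λ e → p≢q (toℕ-fromℕ<-cong e)) ,
    subst (CycleAdjacent (toℕ i)) (sym (toℕ-fromℕ< p<m)) i~p ,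
    subst (CycleAdjacent (toℕ i)) (sym (toℕ-fromℕ< q<m)) i~q
    where
    toℕ-fromℕ<-cong : fromℕ< p<m ≡ fromℕ< q<m → p ≡ q
    toℕ-fromℕ<-cong e = trans (sym (toℕ-fromℕ< p<m)) (trans (cong toℕ e) (toℕ-fromℕ< q<m))

  rim-non-neighbour : ∀ (i : Fin m) → ∃[ j ] j ≢ i × adj G (rim j) (rim i) ≡ false
  rim-non-neighbour zero =
    suc (suc zero) , (λ ()) , dec-false (cycleAdjacent? 2 0) (¬CycleAdjacent-+2 0 ∘ swap)
  rim-non-neighbour (suc zero) =
    suc (suc (suc zero)) , (λ ()) , dec-false (cycleAdjacent? 3 1) (¬CycleAdjacent-+2 1 ∘ swap)
  rim-non-neighbour (suc (suc i)) =
    i′ , (λ e → <⇒≢ (m<n+m (toℕ i) (s≤s z≤n)) (trans (sym toℕi′≡i) (cong toℕ e))) ,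
    dec-false (cycleAdjacent? (toℕ i′) (2 + toℕ i))
              (¬CycleAdjacent-+2 (toℕ i) ∘ subst (λ t → CycleAdjacent t (2 + toℕ i)) toℕi′≡i)
    where
    i′ : Fin m
    i′ = inject₁ (inject₁ i)
    toℕi′≡i : toℕ i′ ≡ toℕ i
    toℕi′≡i = trans (toℕ-inject₁ (inject₁ i)) (toℕ-inject₁ i)

  adjacent-to-rim⇒5≤degree : ∀ {x} → (∀ {i} → adj G x (rim i) ≡ true) → 5 ≤ ∣ neighbours G x ∣
  adjacent-to-rim⇒5≤degree {x} x~rim = begin
    5                                       ≤⟨ s≤s (s≤s (s≤s (s≤s (s≤s z≤n)))) ⟩
    m                                       ≡⟨ ∣⊤∣≡n m ⟨
    ∣ outside ∷ outside ∷ outside ∷ ⊤ {m} ∣ ≤⟨ p⊆q⇒∣p∣≤∣q∣ rim⊆N ⟩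
    ∣ neighbours G x ∣                      ∎
    where
    open ≤-Reasoning
    rim⊆N : outside ∷ outside ∷ outside ∷ ⊤ {m} ⊆ neighbours G x
    rim⊆N (there (there (there _))) = x∈neighbours⁺ G {x} x~rim

  minDegree : ∀ x → 5 ≤ ∣ neighbours G x ∣
  minDegree hub   = adjacent-to-rim⇒5≤degree {hub} refl
  minDegree twin₁ = adjacent-to-rim⇒5≤degree {twin₁} refl
  minDegree twin₂ = adjacent-to-rim⇒5≤degree {twin₂} refl
  minDegree (rim i) with rim-neighbours i
  ... | j , l , j≢l , i~j , i~l = ≤-trans (s≤s (s≤s (s≤s (x≢y⇒2≤∣⁅x⁆∪⁅y⁆∣ j≢l)))) (p⊆q⇒∣p∣≤∣q∣ ⊆N)
    where
    ⊆N : withHubAndTwins (⁅ j ⁆ ∪ ⁅ l ⁆) ⊆ neighbours G (rim i)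
    ⊆N here                      = x∈neighbours⁺ G {rim i} refl
    ⊆N (there here)              = x∈neighbours⁺ G {rim i} refl
    ⊆N (there (there here))      = x∈neighbours⁺ G {rim i} refl
    ⊆N (there (there (there z∈))) with x∈p∪q⁻ ⁅ j ⁆ ⁅ l ⁆ z∈
    ... | inj₁ z∈⁅j⁆ rewrite x∈⁅y⁆⇒x≡y j z∈⁅j⁆ = x∈neighbours⁺ G {rim i} (rim-adjacent⁺ i~j)
    ... | inj₂ z∈⁅l⁆ rewrite x∈⁅y⁆⇒x≡y l z∈⁅l⁆ = x∈neighbours⁺ G {rim i} (rim-adjacent⁺ i~l)

  blueUpTo : ℕ → Subset (3 + m)
  blueUpTo j = withHubAndTwins (upTo j)

  rim-forces-next : ∀ {j} → 1 ≤ j → suc j < m → Force G (blueUpTo j) (blueUpTo (suc j))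
  rim-forces-next {j} 1≤j 1+j<m =
    subst (Force G (blueUpTo j)) (cong withHubAndTwins (upTo-extend toℕnxt))
          (force (rim cur) (rim nxt) cur∈ nxt∉ cur~nxt others)
    where
    j<m = <-trans (n<1+n j) 1+j<m
    cur nxt : Fin m
    cur = fromℕ< j<m
    nxt = fromℕ< 1+j<m
    toℕcur : toℕ cur ≡ j
    toℕcur = toℕ-fromℕ< j<m
    toℕnxt : toℕ nxt ≡ suc j
    toℕnxt = toℕ-fromℕ< 1+j<m
    cur∈ : rim cur ∈ blueUpTo j
    cur∈ = there (there (there (x∈upTo⁺ (≤-reflexive toℕcur))))
    nxt∉ : rim nxt ∉ blueUpTo j
    nxt∉ (there (there (there nxt∈))) = 1+n≰n (subst (_≤ j) toℕnxt (x∈upTo⁻ nxt∈))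
    cur~nxt : adj G (rim cur) (rim nxt) ≡ true
    cur~nxt = rim-adjacent⁺ (subst₂ CycleAdjacent (sym toℕcur) (sym toℕnxt) (inj₁ (inj₁ refl)))
    others : ∀ w → adj G (rim cur) w ≡ true → w ≢ rim nxt → w ∈ blueUpTo j
    others hub     _ _ = here
    others twin₁   _ _ = there here
    others twin₂   _ _ = there (there here)
    others (rim t) cur~t t≢nxt = there (there (there (x∈upTo⁺ t≤j)))
      where
      t≤j : toℕ t ≤ j
      t≤j = cycleAdjacent-≤ 1≤j (subst (λ c → CycleAdjacent c (toℕ t)) toℕcur (rim-adjacent⁻ cur~t))
                              λ e → t≢nxt (cong rim (toℕ-injective (trans e (sym toℕnxt))))

  blueUpTo-forces : ∀ d {j} → 1 ≤ j → d + suc j ≡ m → Forces G (blueUpTo j) ⊤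
  blueUpTo-forces zero    1≤j 1+j≡m =
    subst (λ B → Forces G B ⊤)
          (sym (cong withHubAndTwins (upTo-full (≤-reflexive (sym 1+j≡m))))) done
  blueUpTo-forces (suc d) {j} 1≤j d+2+j≡m =
    step (rim-forces-next 1≤j 1+j<m)
         (blueUpTo-forces d (≤-trans 1≤j (n≤1+n j)) (trans (+-suc d (suc j)) d+2+j≡m))
    where
    1+j<m : suc j < m
    1+j<m = subst (suc j <_) d+2+j≡m (s≤s (m≤n+m (suc j) d))

  ∣blueUpTo1∣≡5 : ∣ blueUpTo 1 ∣ ≡ 5
  ∣blueUpTo1∣≡5 = cong (λ c → 5 + c) (trans (cong ∣_∣ (tabulate-false≡⊥ {4 + k})) (∣⊥∣≡0 (4 + k)))

  S₀ : Subset (3 + m)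
  S₀ = ⊤ [ hub ]≔ outside [ twin₁ ]≔ outside

  S₀-zfs : IsZFS G S₀
  S₀-zfs = ⊤-minus-two-zfs G {hub} {twin₁} {twin₂} refl refl refl λ ()

  S₀-minimal : ∀ T → T ⊂ S₀ → ¬ IsZFS G T
  S₀-minimal T (T⊆S₀ , x , x∈S₀ , x∉T) = stalled⇒¬zfs G x∉T stuck
    where
    hub∉T : hub ∉ T
    hub∉T hub∈T with T⊆S₀ hub∈T
    ... | ()
    twin₁∉T : twin₁ ∉ T
    twin₁∉T twin₁∈T with T⊆S₀ twin₁∈T
    ... | there ()
    twin₂-stuck : ∀ x → x ∈ S₀ → x ∉ T → twin₂ ∈ T → TwoWhiteNeighbours G T twin₂
    twin₂-stuck twin₁   (there ()) _ _
    twin₂-stuck twin₂   _ x∉T twin₂∈T = contradiction twin₂∈T x∉T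
    twin₂-stuck (rim i) _ x∉T _      = twoWhite hub (rim i) (λ ()) refl refl hub∉T x∉T
    stuck : ∀ u → u ∈ T → TwoWhiteNeighbours G T u
    stuck hub     hub∈T   = contradiction hub∈T hub∉T
    stuck twin₁   twin₁∈T = contradiction twin₁∈T twin₁∉T
    stuck twin₂   twin₂∈T = twin₂-stuck x x∈S₀ x∉T twin₂∈T
    stuck (rim i) _       = twoWhite hub twin₁ (λ ()) refl refl hub∉T twin₁∉T

  zfs-avoiding : ∀ w → ∃[ T ] IsZFS G T × w ∉ T × ∃[ y ] y ≢ w × y ∉ T
  zfs-avoiding hub   = S₀ , S₀-zfs , (λ ()) , twin₁ , (λ ()) , λ { (there ()) }
  zfs-avoiding twin₁ = S₀ , S₀-zfs , (λ { (there ()) }) , hub , (λ ()) , λ ()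
  zfs-avoiding twin₂ =
    ⊤ [ hub ]≔ outside [ twin₂ ]≔ outside ,
    ⊤-minus-two-zfs G {hub} {twin₂} {twin₁} refl refl refl (λ ()) ,
    (λ { (there (there ())) }) , hub , (λ ()) , λ ()
  zfs-avoiding (rim i) with rim-non-neighbour i
  ... | j , j≢i , j≁i =
    ⊤ [ hub ]≔ outside [ rim i ]≔ outside ,
    ⊤-minus-two-zfs G {hub} {rim i} {rim j} refl refl j≁i (j≢i ∘ rim-injective) ,
    x∉p[x]≔outside (⊤ [ hub ]≔ outside) (rim i) , hub , (λ ()) , λ ()

  Z≡5 : IsZ G 5
  Z≡5 = (blueUpTo 1 , blueUpTo-forces (4 + k) (s≤s z≤n) (+-comm (4 + k) 2) , ∣blueUpTo1∣≡5) ,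
        λ _ → zfs-size-≥-minDegree G minDegree

  Zbar≡n-2 : IsZbar G (suc m)
  Zbar≡n-2 = (S₀ , (S₀-zfs , S₀-minimal) , ∣⊤∣≡n (suc m)) ,
             λ _ → ≤-pred ∘ ≤-pred ∘ minimal-zfs-size-≤ G zfs-avoiding

proposition3p9 : (N : ℕ) → Σ ℕ λ n → N ≤ n × Σ (Graph n) λ G → Σ ℕ λ z → Σ ℕ λ zb →
                   IsZ G z × IsZbar G zb × (+ zb - + z ≡ + n - + 7)
proposition3p9 N = 9 + N , m≤n+m N 9 , G , 5 , 7 + N , Z≡5 , Zbar≡n-2 , refl
  where open Construction N
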